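{- Let $\Phi=(G,\varphi)$ be a connected signed digraph whose Eisenstein matrix has rank $2$. Then $G$ is a complete bipartite graph and $\Phi$ is switching isomorphic to $G$ (i.e., to the signed digraph on $G$ with all gains equal to $1$).
   Context: Let $\omega=e^{i\pi/3}$ and $\mathbb{T}_6=\{\omega^k: k=0,\dots,5\}$. A signed digraph $\Phi=(G,\varphi)$ consists of a finite simple graph $G$ (its underlying graph) and a map $\varphi$ assigning to every ordered pair $(u,v)$ of adjacent vertices a value $\varphi(u,v)\in\mathbb{T}_6$ with $\varphi(v,u)=\overline{\varphi(u,v)}$; $\Phi$ is connected if $G$ is. Its Eisenstein matrix $\mathcal{E}(\Phi)$ is the Hermitian matrix with $\mathcal{E}_{uv}=\varphi(u,v)$ for adjacent $u,v$ and $0$ otherwise. A graph is regarded as the signed digraph with all gains $1$. Two signed digraphs are switching isomorphic if one can be obtained from the other by a sequence of the operations: $\mathcal{E}\mapsto X\mathcal{E}X^{ -1}$ with $X$ diagonal with diagonal entries in $\mathbb{T}_6$; relabeling vertices; taking the converse ($\mathcal{E}\mapsto\mathcal{E}^\top$). -}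

module Defs where

open import Data.Nat using (ℕ; zero; suc)
open import Data.Integer as ℤ using (ℤ; +_; -_)
open import Data.Fin using (Fin; zero; suc; punchIn)
open import Data.Bool using (Bool; true; false; if_then_else_)
open import Data.Product using (_×_; _,_; ∃; ∃-syntax; Σ-syntax)
open import Relation.Binary.PropositionalEquality using (_≡_; _≢_)
open import Relation.Binary.Construct.Closure.ReflexiveTransitive using (Star)
open import Data.Fin.Permutation using (Permutation′; _⟨$⟩ʳ_)

-- Eisenstein integers ℤ[ω], ω = e^{iπ/3}, ω² = ω - 1.
-- The pair (a , b) represents a + b ω (unique representation).

Eis : Set
Eis = ℤ × ℤ

0E 1E : Eis
0E = (+ 0 , + 0)
1E = (+ 1 , + 0)

_+E_ : Eis → Eis → Eis
(a , b) +E (c , d) = (a ℤ.+ c , b ℤ.+ d)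

-E_ : Eis → Eis
-E (a , b) = (ℤ.- a , ℤ.- b)

_-E_ : Eis → Eis → Eis
x -E y = x +E (-E y)

-- (a + bω)(c + dω) = (ac - bd) + (ad + bc + bd) ω
_*E_ : Eis → Eis → Eis
(a , b) *E (c , d) = (a ℤ.* c ℤ.- b ℤ.* d , a ℤ.* d ℤ.+ b ℤ.* c ℤ.+ b ℤ.* d)

-- T6 = {ω^k : k = 0..5}, represented by the exponent k : Fin 6.
ωpow : Fin 6 → Eis
ωpow zero = (+ 1 , + 0)
ωpow (suc zero) = (+ 0 , + 1)
ωpow (suc (suc zero)) = (- + 1 , + 1)
ωpow (suc (suc (suc zero))) = (- + 1 , + 0)
ωpow (suc (suc (suc (suc zero)))) = (+ 0 , - + 1)
ωpow (suc (suc (suc (suc (suc zero))))) = (+ 1 , - + 1)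

-- complex conjugation on T6 (in exponents): k ↦ -k mod 6
conj6 : Fin 6 → Fin 6
conj6 zero = zero
conj6 (suc zero) = suc (suc (suc (suc (suc zero))))
conj6 (suc (suc zero)) = suc (suc (suc (suc zero)))
conj6 (suc (suc (suc zero))) = suc (suc (suc zero))
conj6 (suc (suc (suc (suc zero)))) = suc (suc zero)
conj6 (suc (suc (suc (suc (suc zero))))) = suc zero

record SignedDigraph (n : ℕ) : Set where
  field
    adj       : Fin n → Fin n → Bool
    adj-irr   : ∀ u → adj u u ≡ false
    adj-sym   : ∀ u v → adj u v ≡ adj v u
    -- gains (only meaningful on adjacent pairs), as exponents of ω
    gain      : Fin n → Fin n → Fin 6
    gain-conj : ∀ u v → adj u v ≡ true → gain v u ≡ conj6 (gain u v)

open SignedDigraph public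

Matrix : ℕ → Set
Matrix n = Fin n → Fin n → Eis

eisenstein : ∀ {n} → SignedDigraph n → Matrix n
eisenstein Φ u v = if adj Φ u v then ωpow (gain Φ u v) else 0E

-- adjacency matrix of the underlying graph G (= Eisenstein matrix with all gains 1)
adjMatrix : ∀ {n} → SignedDigraph n → Matrix n
adjMatrix Φ u v = if adj Φ u v then 1E else 0E

data Walk {n} (Φ : SignedDigraph n) : Fin n → Fin n → Set where
  here : ∀ {u} → Walk Φ u u
  step : ∀ {u w v} → adj Φ u w ≡ true → Walk Φ w v → Walk Φ u v

Connected : ∀ {n} → SignedDigraph n → Set
Connected Φ = ∀ u v → Walk Φ u v

CompleteBipartite : ∀ {n} → SignedDigraph n → Set
CompleteBipartite {n} Φ =
  Σ[ side ∈ (Fin n → Bool) ] ((∃[ u ] side u ≡ true) × (∃[ v ] side v ≡ false) ×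
             (∀ u v → (adj Φ u v ≡ true → side u ≢ side v) ×
                      (side u ≢ side v → adj Φ u v ≡ true)))

altSum : ∀ {k} → (Fin k → Eis) → Eis
altSum {zero} f = 0E
altSum {suc k} f = f zero -E altSum (λ j → f (suc j))

det : ∀ {k} → (Fin k → Fin k → Eis) → Eis
det {zero} A = 1E
det {suc k} A = altSum (λ j → A zero j *E det (λ r c → A (suc r) (punchIn j c)))

minor : ∀ {n r} → Matrix n → (Fin r → Fin n) → (Fin r → Fin n) → Eis
minor M rows cols = det (λ a b → M (rows a) (cols b))

-- determinantal rank: rank M = r  iff  some r×r minor is nonzero and
-- all (r+1)×(r+1) minors vanish (index maps with repetitions give 0 anyway)
HasRank : ∀ {n} → Matrix n → ℕ → Set
HasRank {n} M r =
  (∃[ rows ] ∃[ cols ] minor {n} {r} M rows cols ≢ 0E) ×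
  (∀ (rows cols : Fin (suc r) → Fin n) → minor M rows cols ≡ 0E)

data SwitchStep {n} (A B : Matrix n) : Set where
  -- B = X A X⁻¹ with X = diag(ω^{x u})
  switch   : (x : Fin n → Fin 6) →
             (∀ u v → B u v ≡ (ωpow (x u) *E A u v) *E ωpow (conj6 (x v))) →
             SwitchStep A B
  relabel  : (σ : Permutation′ n) →
             (∀ u v → B u v ≡ A (σ ⟨$⟩ʳ u) (σ ⟨$⟩ʳ v)) → SwitchStep A B
  converse : (∀ u v → B u v ≡ A v u) → SwitchStep A B

SwitchingIsomorphic : ∀ {n} → SignedDigraph n → Matrix n → Set
SwitchingIsomorphic Φ B = Star SwitchStep (eisenstein Φ) B

{-# OPTIONS --safe #-}
-- A triangle u v w with gains ω^a, ω^b, ω^c on uv, uw, vw gives the principal minor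
-- z + z̄ = 2 Re z ∈ {±1, ±2}, where z = ω^(a+c-b), so G is triangle-free. If a vertex w missed
-- both ends of an edge ab, a neighbour z of w would give the lower triangular minor with rows
-- (w, a, b), columns (z, b, a) and unit diagonal; so every vertex is adjacent to an end of every
-- edge. Splitting the vertices by adjacency to v₀, for a fixed edge u₀v₀, therefore makes G
-- complete bipartite. For every square u₀ v₀ u v the minor with rows (v₀, u₀, u) and columns
-- (u₀, v₀, v) is ω^-g(u₀v₀) (ω^g(u₀v₀) ω^g(uv) - ω^g(u₀v) ω^g(uv₀)), so all these squares are
-- balanced, and a switching that trivialises the gains on the star of v₀ and on u₀v₀
-- trivialises all gains.
module Submission where

open import Defs
open import Data.Nat as ℕ using (ℕ)
open import Data.Nat.DivMod using (_mod_)
open import Data.Bool using (true; false; if_then_else_)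
open import Data.Bool.Properties using (¬-not; not-¬)
open import Data.Empty using (⊥; ⊥-elim)
open import Data.Fin using (Fin; suc; toℕ; punchIn)
open import Data.Fin.Patterns using (0F; 1F; 2F)
open import Data.Fin.Properties using (all?; ¬∀⟶∃¬) renaming (_≟_ to _≟F_)
open import Data.Integer as ℤ using ()
open import Data.Integer.Properties as ℤ using ()
open import Data.Product using (_×_; _,_; proj₂; ∃-syntax)
open import Data.Product.Properties using (≡-dec)
open import Data.Sum using (_⊎_; inj₁; inj₂)
open import Data.Vec.Functional using (_∷_; [])
open import Function using (_∘_)
open import Relation.Binary.Construct.Closure.ReflexiveTransitive using (ε; _◅_)
open import Relation.Binary.Definitions using (DecidableEquality)
open import Relation.Binary.PropositionalEquality
open import Relation.Nullary using (¬?; _→-dec_)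
open import Relation.Nullary.Decidable using (from-yes)

infix 4 _≟E_

_≟E_ : DecidableEquality Eis
_≟E_ = ≡-dec ℤ._≟_ ℤ._≟_

*E-zeroʳ : ∀ x → x *E 0E ≡ 0E
*E-zeroʳ (a , b) rewrite ℤ.*-zeroʳ a | ℤ.*-zeroʳ b = refl

*E-identityʳ : ∀ x → x *E 1E ≡ x
*E-identityʳ (a , b) rewrite ℤ.*-identityʳ a | ℤ.*-identityʳ b | ℤ.*-zeroʳ a | ℤ.*-zeroʳ b =
  cong₂ _,_ (ℤ.+-identityʳ a) (trans (ℤ.+-identityʳ _) (ℤ.+-identityˡ b))

-E-identityʳ : ∀ x → x -E 0E ≡ x
-E-identityʳ (a , b) = cong₂ _,_ (ℤ.+-identityʳ a) (ℤ.+-identityʳ b)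

infixl 6 _⊕_

_⊕_ : Fin 6 → Fin 6 → Fin 6
a ⊕ b = (toℕ a ℕ.+ toℕ b) mod 6

ωpow-⊕ : ∀ a b → ωpow (a ⊕ b) ≡ ωpow a *E ωpow b
ωpow-⊕ = from-yes (all? λ a → all? λ b → ωpow (a ⊕ b) ≟E ωpow a *E ωpow b)

ωpow-inverseʳ : ∀ a → ωpow a *E ωpow (conj6 a) ≡ 1E
ωpow-inverseʳ = from-yes (all? λ a → ωpow a *E ωpow (conj6 a) ≟E 1E)

ωpow≢0E : ∀ a → ωpow a ≢ 0E
ωpow≢0E = from-yes (all? λ a → ¬? (ωpow a ≟E 0E))

ωᵏ*[ωᵃ-ωᵇ]≡0⇒a≡b : ∀ k a b → ωpow k *E (ωpow a -E ωpow b) ≡ 0E → a ≡ b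
ωᵏ*[ωᵃ-ωᵇ]≡0⇒a≡b = from-yes (all? λ k → all? λ a → all? λ b →
  (ωpow k *E (ωpow a -E ωpow b) ≟E 0E) →-dec (a ≟F b))

⊕-moveʳ : ∀ a b c → a ⊕ b ≡ c → c ⊕ conj6 b ≡ a
⊕-moveʳ = from-yes (all? λ a → all? λ b → all? λ c →
  (a ⊕ b ≟F c) →-dec (c ⊕ conj6 b ≟F a))

⊕-transpose : ∀ a b c d → a ⊕ d ≡ b ⊕ c → conj6 c ⊕ d ≡ b ⊕ conj6 a
⊕-transpose = from-yes (all? λ a → all? λ b → all? λ c → all? λ d →
  (a ⊕ d ≟F b ⊕ c) →-dec (conj6 c ⊕ d ≟F b ⊕ conj6 a))

altSum-cong : ∀ {k} {f g : Fin k → Eis} → (∀ j → f j ≡ g j) → altSum f ≡ altSum g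
altSum-cong {ℕ.zero}  f≗g = refl
altSum-cong {ℕ.suc k} f≗g = cong₂ _-E_ (f≗g 0F) (altSum-cong (f≗g ∘ suc))

altSum-zero : ∀ {k} {f : Fin k → Eis} → (∀ j → f j ≡ 0E) → altSum f ≡ 0E
altSum-zero {ℕ.zero}  f≡0 = refl
altSum-zero {ℕ.suc k} f≡0 = cong₂ _-E_ (f≡0 0F) (altSum-zero (f≡0 ∘ suc))

det-cong : ∀ {k} {A B : Matrix k} → (∀ i j → A i j ≡ B i j) → det A ≡ det B
det-cong {ℕ.zero}  A≗B = refl
det-cong {ℕ.suc k} A≗B =
  altSum-cong λ j → cong₂ _*E_ (A≗B 0F j) (det-cong λ r c → A≗B (suc r) (punchIn j c))

det-1×1 : (A : Matrix 1) → det A ≡ A 0F 0F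
det-1×1 A = trans (-E-identityʳ (A 0F 0F *E 1E)) (*E-identityʳ (A 0F 0F))

det-2×2 : (A : Matrix 2) → det A ≡ (A 0F 0F *E A 1F 1F) -E (A 0F 1F *E A 1F 0F)
det-2×2 A = cong₂ (λ x y → (A 0F 0F *E x) -E y)
  (det-1×1 λ r c → A (suc r) (punchIn 0F c))
  (trans (-E-identityʳ (A 0F 1F *E det (λ r c → A (suc r) (punchIn 1F c))))
         (cong (A 0F 1F *E_) (det-1×1 λ r c → A (suc r) (punchIn 1F c))))

det-expandFirstRow : ∀ {k} (A : Matrix (ℕ.suc k)) → (∀ j → A 0F (suc j) ≡ 0E) →
                     det A ≡ A 0F 0F *E det (λ i j → A (suc i) (suc j))
det-expandFirstRow A row≡0 =
  trans (cong (_-E_ (A 0F 0F *E det (λ i j → A (suc i) (suc j))))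
              (altSum-zero λ j → cong (_*E det (λ r c → A (suc r) (punchIn (suc j) c))) (row≡0 j)))
        (-E-identityʳ (A 0F 0F *E det (λ i j → A (suc i) (suc j))))

det-zeroFirstRow : ∀ {k} (A : Matrix (ℕ.suc k)) → (∀ j → A 0F j ≡ 0E) → det A ≡ 0E
det-zeroFirstRow A row≡0 =
  trans (det-expandFirstRow A (row≡0 ∘ suc)) (cong (_*E det (λ i j → A (suc i) (suc j))) (row≡0 0F))

det≢0⇒firstRow≢0 : ∀ {k} (A : Matrix (ℕ.suc k)) → det A ≢ 0E → ∃[ j ] A 0F j ≢ 0E
det≢0⇒firstRow≢0 {k} A det≢0 =
  ¬∀⟶∃¬ (ℕ.suc k) (λ j → A 0F j ≡ 0E) (λ j → A 0F j ≟E 0E) (det≢0 ∘ det-zeroFirstRow A)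

det-lowerTriangular₃ : (A : Matrix 3) → A 0F 1F ≡ 0E → A 0F 2F ≡ 0E → A 1F 2F ≡ 0E →
                       det A ≡ A 0F 0F *E (A 1F 1F *E A 2F 2F)
det-lowerTriangular₃ A a₀₁ a₀₂ a₁₂ = begin
  det A
    ≡⟨ det-expandFirstRow A (λ { 0F → a₀₁ ; 1F → a₀₂ }) ⟩
  A 0F 0F *E det (λ i j → A (suc i) (suc j))
    ≡⟨ cong (A 0F 0F *E_) (det-expandFirstRow (λ i j → A (suc i) (suc j)) λ { 0F → a₁₂ }) ⟩
  A 0F 0F *E (A 1F 1F *E det (λ i j → A (suc (suc i)) (suc (suc j))))
    ≡⟨ cong (λ x → A 0F 0F *E (A 1F 1F *E x)) (det-1×1 λ i j → A (suc (suc i)) (suc (suc j))) ⟩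
  A 0F 0F *E (A 1F 1F *E A 2F 2F) ∎
  where open ≡-Reasoning

hermitianTriangle : Fin 6 → Fin 6 → Fin 6 → Matrix 3
hermitianTriangle a b c =
  (0E                ∷ ωpow a            ∷ ωpow b ∷ []) ∷
  (ωpow (conj6 a)    ∷ 0E                ∷ ωpow c ∷ []) ∷
  (ωpow (conj6 b)    ∷ ωpow (conj6 c)    ∷ 0E     ∷ []) ∷ []

det-hermitianTriangle≢0 : ∀ a b c → det (hermitianTriangle a b c) ≢ 0E
det-hermitianTriangle≢0 = from-yes (all? λ a → all? λ b → all? λ c →
  ¬? (det (hermitianTriangle a b c) ≟E 0E))

MinorsVanish : ∀ {n} → Matrix n → ℕ → Set
MinorsVanish {n} M r = ∀ (rows cols : Fin r → Fin n) → minor M rows cols ≡ 0E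

module _ {n} (Φ : SignedDigraph n) where

  private
    E : Matrix n
    E = eisenstein Φ

    g : Fin n → Fin n → Fin 6
    g = gain Φ

  variable
    u v w u₀ v₀ : Fin n

  adj-flip : adj Φ u v ≡ true → adj Φ v u ≡ true
  adj-flip {u} {v} uv = trans (sym (adj-sym Φ u v)) uv

  eisenstein-adj : adj Φ u v ≡ true → E u v ≡ ωpow (g u v)
  eisenstein-adj uv rewrite uv = refl

  eisenstein-adj-conj : adj Φ u v ≡ true → E v u ≡ ωpow (conj6 (g u v))
  eisenstein-adj-conj {u} {v} uv =
    trans (eisenstein-adj (adj-flip uv)) (cong ωpow (gain-conj Φ u v uv))

  eisenstein-nonadj : adj Φ u v ≡ false → E u v ≡ 0E
  eisenstein-nonadj uv rewrite uv = refl

  eisenstein-diag : ∀ u → E u u ≡ 0E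
  eisenstein-diag u = eisenstein-nonadj (adj-irr Φ u)

  eisenstein≢0⇒adj : E u v ≢ 0E → adj Φ u v ≡ true
  eisenstein≢0⇒adj {u} {v} Euv≢0 = ¬-not λ uv → Euv≢0 (eisenstein-nonadj uv)

  walk-neighbour : Walk Φ u v → u ≢ v → ∃[ z ] adj Φ u z ≡ true
  walk-neighbour here        u≢u = ⊥-elim (u≢u refl)
  walk-neighbour (step uz _) _   = _ , uz

  adj? : ∀ u v → adj Φ u v ≡ true ⊎ adj Φ u v ≡ false
  adj? u v with adj Φ u v
  ... | true  = inj₁ refl
  ... | false = inj₂ refl

  module _ (minors₃≡0 : MinorsVanish E 3) where

    triangleFree : adj Φ u v ≡ true → adj Φ v w ≡ true → adj Φ u w ≡ true → ⊥
    triangleFree {u} {v} {w} uv vw uw =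
      det-hermitianTriangle≢0 (g u v) (g u w) (g v w)
        (trans (sym (det-cong entries)) (minors₃≡0 triangle triangle))
      where
      triangle : Fin 3 → Fin n
      triangle = u ∷ v ∷ w ∷ []
      entries : ∀ i j → E (triangle i) (triangle j)
                        ≡ hermitianTriangle (g u v) (g u w) (g v w) i j
      entries 0F 0F = eisenstein-diag u
      entries 0F 1F = eisenstein-adj uv
      entries 0F 2F = eisenstein-adj uw
      entries 1F 0F = eisenstein-adj-conj uv
      entries 1F 1F = eisenstein-diag v
      entries 1F 2F = eisenstein-adj vw
      entries 2F 0F = eisenstein-adj-conj uw
      entries 2F 1F = eisenstein-adj-conj vw
      entries 2F 2F = eisenstein-diag w

    nonadj-of-triangle : adj Φ v w ≡ true → adj Φ u w ≡ true → adj Φ u v ≡ false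
    nonadj-of-triangle vw uw = ¬-not {y = true} λ uv → triangleFree uv vw uw

    nonadj-to-both-ends⇒⊥ : Connected Φ → adj Φ u v ≡ true →
                            adj Φ w u ≡ false → adj Φ w v ≡ false → ⊥
    nonadj-to-both-ends⇒⊥ {a} {b} {w} connected ab wa wb
      with walk-neighbour (connected w a) (λ { refl → not-¬ ab wb })
    ... | z , wz = ωpow≢0E (g w z ⊕ (g a b ⊕ conj6 (g a b))) (begin
      ωpow (g w z ⊕ (g a b ⊕ conj6 (g a b)))
        ≡⟨ trans (ωpow-⊕ (g w z) (g a b ⊕ conj6 (g a b)))
                 (cong (ωpow (g w z) *E_) (ωpow-⊕ (g a b) (conj6 (g a b)))) ⟩
      ωpow (g w z) *E (ωpow (g a b) *E ωpow (conj6 (g a b)))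
        ≡⟨ sym (cong₂ _*E_ (eisenstein-adj wz)
                            (cong₂ _*E_ (eisenstein-adj ab) (eisenstein-adj-conj ab))) ⟩
      E w z *E (E a b *E E b a)
        ≡⟨ sym (det-lowerTriangular₃ (λ i j → E (rows i) (cols j))
                  (eisenstein-nonadj wb) (eisenstein-nonadj wa) (eisenstein-diag a)) ⟩
      minor E rows cols
        ≡⟨ minors₃≡0 rows cols ⟩
      0E ∎)
      where
      open ≡-Reasoning
      rows cols : Fin 3 → Fin n
      rows = w ∷ a ∷ b ∷ []
      cols = z ∷ b ∷ a ∷ []

    edge-dominating : Connected Φ → adj Φ u v ≡ true → adj Φ w v ≡ false → adj Φ w u ≡ true
    edge-dominating {u} {v} {w} connected uv wv with adj? w u
    ... | inj₁ wu = wu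
    ... | inj₂ wu = ⊥-elim (nonadj-to-both-ends⇒⊥ connected uv wu wv)

    square-balanced : adj Φ u₀ v₀ ≡ true → adj Φ u v₀ ≡ true → adj Φ u₀ v ≡ true →
                      adj Φ u v ≡ true → g u₀ v₀ ⊕ g u v ≡ g u₀ v ⊕ g u v₀
    square-balanced {u₀} {v₀} {u} {v} u₀v₀ uv₀ u₀v uv =
      ωᵏ*[ωᵃ-ωᵇ]≡0⇒a≡b (conj6 (g u₀ v₀)) (g u₀ v₀ ⊕ g u v) (g u₀ v ⊕ g u v₀) (begin
        ωpow (conj6 (g u₀ v₀)) *E (ωpow (g u₀ v₀ ⊕ g u v) -E ωpow (g u₀ v ⊕ g u v₀))
          ≡⟨ cong (ωpow (conj6 (g u₀ v₀)) *E_)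
                  (cong₂ _-E_ (ωpow-⊕ (g u₀ v₀) (g u v)) (ωpow-⊕ (g u₀ v) (g u v₀))) ⟩
        ωpow (conj6 (g u₀ v₀))
          *E ((ωpow (g u₀ v₀) *E ωpow (g u v)) -E (ωpow (g u₀ v) *E ωpow (g u v₀)))
          ≡⟨ sym (cong₂ _*E_ (eisenstein-adj-conj u₀v₀)
                   (cong₂ _-E_ (cong₂ _*E_ (eisenstein-adj u₀v₀) (eisenstein-adj uv))
                               (cong₂ _*E_ (eisenstein-adj u₀v) (eisenstein-adj uv₀)))) ⟩
        E v₀ u₀ *E ((E u₀ v₀ *E E u v) -E (E u₀ v *E E u v₀))
          ≡⟨ sym (cong (E v₀ u₀ *E_) (det-2×2 λ i j → E (rows (suc i)) (cols (suc j)))) ⟩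
        E v₀ u₀ *E det (λ i j → E (rows (suc i)) (cols (suc j)))
          ≡⟨ sym (det-expandFirstRow (λ i j → E (rows i) (cols j))
                   λ { 0F → eisenstein-diag v₀ ; 1F → eisenstein-nonadj v₀v }) ⟩
        minor E rows cols
          ≡⟨ minors₃≡0 rows cols ⟩
        0E ∎)
      where
      open ≡-Reasoning
      rows cols : Fin 3 → Fin n
      rows = v₀ ∷ u₀ ∷ u ∷ []
      cols = u₀ ∷ v₀ ∷ v ∷ []
      v₀v : adj Φ v₀ v ≡ false
      v₀v = nonadj-of-triangle (adj-flip u₀v) (adj-flip u₀v₀)

    module _ (connected : Connected Φ) (u₀v₀ : adj Φ u₀ v₀ ≡ true) where

      adj⇒sidesDiffer : adj Φ u v ≡ true → adj Φ u v₀ ≢ adj Φ v v₀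
      adj⇒sidesDiffer {u} {v} uv same with adj? u v₀ | adj? v v₀
      ... | inj₁ uv₀ | inj₁ vv₀ = triangleFree uv vv₀ uv₀
      ... | inj₂ uv₀ | inj₂ vv₀ =
        triangleFree uv (edge-dominating connected u₀v₀ vv₀) (edge-dominating connected u₀v₀ uv₀)
      ... | inj₁ uv₀ | inj₂ vv₀ = not-¬ (trans (sym same) uv₀) vv₀
      ... | inj₂ uv₀ | inj₁ vv₀ = not-¬ (trans same vv₀) uv₀

      sidesDiffer⇒adj : adj Φ u v₀ ≢ adj Φ v v₀ → adj Φ u v ≡ true
      sidesDiffer⇒adj {u} {v} differ with adj? u v₀ | adj? v v₀
      ... | inj₁ uv₀ | inj₁ vv₀ = ⊥-elim (differ (trans uv₀ (sym vv₀)))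
      ... | inj₂ uv₀ | inj₂ vv₀ = ⊥-elim (differ (trans uv₀ (sym vv₀)))
      ... | inj₁ uv₀ | inj₂ vv₀ = adj-flip (edge-dominating connected uv₀ vv₀)
      ... | inj₂ uv₀ | inj₁ vv₀ = edge-dominating connected vv₀ uv₀

      completeBipartite : CompleteBipartite Φ
      completeBipartite =
        (λ w → adj Φ w v₀) , (u₀ , u₀v₀) , (v₀ , adj-irr Φ v₀) ,
        λ u v → adj⇒sidesDiffer , sidesDiffer⇒adj

      -- Switched gains are 1 on the star of v₀ and on u₀v₀, hence, by balance, everywhere.
      switching : Fin n → Fin 6
      switching w = if adj Φ w v₀ then conj6 (g w v₀) else g u₀ w ⊕ conj6 (g u₀ v₀)

      switching-near : adj Φ w v₀ ≡ true → switching w ≡ conj6 (g w v₀)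
      switching-near wv₀ rewrite wv₀ = refl

      switching-far : adj Φ w v₀ ≡ false → switching w ≡ g u₀ w ⊕ conj6 (g u₀ v₀)
      switching-far wv₀ rewrite wv₀ = refl

      switching-across : adj Φ u v₀ ≡ true → adj Φ v v₀ ≡ false → adj Φ u v ≡ true →
                         switching u ⊕ g u v ≡ switching v
      switching-across {u} {v} uv₀ vv₀ uv
        rewrite switching-near uv₀ | switching-far vv₀ =
        ⊕-transpose (g u₀ v₀) (g u₀ v) (g u v₀) (g u v)
          (square-balanced u₀v₀ uv₀ (adj-flip (edge-dominating connected u₀v₀ vv₀)) uv)

      switching-edge : adj Φ u v ≡ true → switching u ⊕ g u v ≡ switching v
      switching-edge {u} {v} uv with adj? u v₀ | adj? v v₀
      ... | inj₁ uv₀ | inj₁ vv₀ = ⊥-elim (adj⇒sidesDiffer uv (trans uv₀ (sym vv₀)))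
      ... | inj₂ uv₀ | inj₂ vv₀ = ⊥-elim (adj⇒sidesDiffer uv (trans uv₀ (sym vv₀)))
      ... | inj₁ uv₀ | inj₂ vv₀ = switching-across uv₀ vv₀ uv
      ... | inj₂ uv₀ | inj₁ vv₀ =
        trans (cong (switching u ⊕_) (gain-conj Φ v u (adj-flip uv)))
              (⊕-moveʳ (switching v) (g v u) (switching u) (switching-across vv₀ uv₀ (adj-flip uv)))

      switching-entry : ∀ u v →
                        adjMatrix Φ u v ≡ (ωpow (switching u) *E E u v) *E ωpow (conj6 (switching v))
      switching-entry u v with adj Φ u v in uv
      ... | false = cong (_*E ωpow (conj6 (switching v))) (sym (*E-zeroʳ (ωpow (switching u))))
      ... | true  = sym (begin
        (ωpow (switching u) *E ωpow (g u v)) *E ωpow (conj6 (switching v))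
          ≡⟨ cong (_*E ωpow (conj6 (switching v))) (sym (ωpow-⊕ (switching u) (g u v))) ⟩
        ωpow (switching u ⊕ g u v) *E ωpow (conj6 (switching v))
          ≡⟨ cong (λ s → ωpow s *E ωpow (conj6 (switching v))) (switching-edge uv) ⟩
        ωpow (switching v) *E ωpow (conj6 (switching v))
          ≡⟨ ωpow-inverseʳ (switching v) ⟩
        1E ∎)
        where open ≡-Reasoning

      switchingIsomorphic : SwitchingIsomorphic Φ (adjMatrix Φ)
      switchingIsomorphic = switch switching switching-entry ◅ ε

proposition4p5 : ∀ (n : ℕ) (Φ : SignedDigraph n) →
    Connected Φ → HasRank (eisenstein Φ) 2 →
    CompleteBipartite Φ × SwitchingIsomorphic Φ (adjMatrix Φ)
proposition4p5 n Φ connected ((rows , cols , minor≢0) , minors₃≡0) =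
  completeBipartite Φ minors₃≡0 connected u₀v₀ , switchingIsomorphic Φ minors₃≡0 connected u₀v₀
  where
  firstRow≢0 = det≢0⇒firstRow≢0 (λ i j → eisenstein Φ (rows i) (cols j)) minor≢0
  u₀v₀ = eisenstein≢0⇒adj Φ (proj₂ firstRow≢0)
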